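{- Let $t$ be a $\lambda$-term and $\rho: t\to^k u$ a standard derivation of the shallow LSC. Then $u$ is a shallow term, i.e. no explicit substitution of $u$ contains an explicit substitution in its content.
   Context: LSC terms: $t::= x\mid \lambda x.t\mid tu\mid t[x\leftarrow u]$ (explicit substitution binding $x$, content $u$), modulo $\alpha$; $\lambda$-terms have no explicit substitutions. Shallow contexts $C::=\langle\cdot\rangle\mid \lambda x.C\mid Ct\mid tC\mid C[x\leftarrow t]$; general contexts also allow $t[x\leftarrow C]$; substitution contexts $L::=\langle\cdot\rangle\mid L[x\leftarrow t]$. Reduction: closure under shallow contexts of ${\tt dB}$: $(L\langle\lambda x.t\rangle)u\to L\langle t[x\leftarrow u]\rangle$ and ${\tt ls}$: $C\langle x\rangle[x\leftarrow u]\to C\langle u\rangle[x\leftarrow u]$ ($C$ not capturing $x$). Positions: ${\tt dB}$-redex $C\langle L\langle\lambda x.t\rangle u\rangle$ has position $C$; ${\tt ls}$-step $D\langle C\langle x\rangle[x\leftarrow u]\rangle\to D\langle C\langle u\rangle[x\leftarrow u]\rangle$ has position $D\langle C[x\leftarrow u]\rangle$. $C\prec_p t$ means $t=C\langle u\rangle$. $\prec_O$: $\langle\cdot\rangle\prec_O C$ for $C\neq\langle\cdot\rangle$, closed under $E\langle\cdot\rangle$. $\prec_L$: if $C\prec_p t$, $D\prec_p u$ then $Cu\prec_L tD$ and $C[x\leftarrow u]\prec_L t[x\leftarrow D]$, closed under $E\langle\cdot\rangle$. $\prec_{LO}=\prec_O\cup\prec_L$. A derivation $R_1;\ldots;R_n$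 is standard if there are no $i\in\{2,\ldots,n\}$, $j<i$ with $R_i$ a residual (standard residual theory of the LSC) of a redex $Q$ of the source of $R_j$ with $Q\prec_{LO}R_j$. -}

module Defs where

open import Data.Nat using (ℕ; zero; suc; _+_; _<ᵇ_; _<_)
open import Data.Bool using (if_then_else_)
open import Data.List using (List; []; _∷_; _++_; length; replicate)
open import Data.List.Relation.Unary.All using (All)
open import Data.Product using (Σ; ∃; _×_; _,_)
open import Data.Sum using (_⊎_)
open import Relation.Nullary using (¬_)
open import Relation.Binary.PropositionalEquality using (_≡_; _≢_)

-- LSC terms, de Bruijn representation (so terms are taken modulo α).
--   var i       : variable (de Bruijn index)
--   lam t       : λx.t            (binds index 0 in t)
--   app t u     : t u
--   es t u      : t[x←u]          (binds index 0 in t, not in u)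

data Tm : Set where
  var : ℕ → Tm
  lam : Tm → Tm
  app : Tm → Tm → Tm
  es  : Tm → Tm → Tm

shift : ℕ → ℕ → Tm → Tm
shift c k (var i)  = if i <ᵇ c then var i else var (i + k)
shift c k (lam t)  = lam (shift (suc c) k t)
shift c k (app t u) = app (shift c k t) (shift c k u)
shift c k (es t u) = es (shift (suc c) k t) (shift c k u)

data LambdaTerm : Tm → Set where
  var : ∀ {i} → LambdaTerm (var i)
  lam : ∀ {t} → LambdaTerm t → LambdaTerm (lam t)
  app : ∀ {t u} → LambdaTerm t → LambdaTerm u → LambdaTerm (app t u)

data ShallowTerm : Tm → Set where
  var : ∀ {i} → ShallowTerm (var i)
  lam : ∀ {t} → ShallowTerm t → ShallowTerm (lam t)
  app : ∀ {t u} → ShallowTerm t → ShallowTerm u → ShallowTerm (app t u)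
  es  : ∀ {t u} → ShallowTerm t → LambdaTerm u → ShallowTerm (es t u)

-- Positions (= contexts, represented as paths from the root to the hole)

data Dir : Set where
  dλ  : Dir   -- λx.C
  dAl : Dir   -- C t
  dAr : Dir   -- t C
  dσl : Dir   -- C[x←t]
  dσr : Dir   -- t[x←C]   (not shallow)

Pos : Set
Pos = List Dir

ShallowPos : Pos → Set
ShallowPos = All (λ d → d ≢ dσr)

-- substitution contexts L = ⟨·⟩[x₁←s₁]…[xₖ←sₖ], given as the list s₁ … sₖ
-- (s₁ innermost)
plugL : List Tm → Tm → Tm
plugL []      t = t
plugL (s ∷ L) t = plugL L (es t s)

-- LsRep u d p t t' : t has at path p an occurrence of the variable bound
-- d binders above the root of t (i.e. index d), and t' is t with that
-- occurrence replaced by u (suitably weakened).  Any (general) context.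
data LsRep (u : Tm) : ℕ → Pos → Tm → Tm → Set where
  here : ∀ {d} → LsRep u d [] (var d) (shift 0 (suc d) u)
  lamC : ∀ {d p t t'} → LsRep u (suc d) p t t' → LsRep u d (dλ ∷ p) (lam t) (lam t')
  appL : ∀ {d p t t' s} → LsRep u d p t t' → LsRep u d (dAl ∷ p) (app t s) (app t' s)
  appR : ∀ {d p t t' s} → LsRep u d p t t' → LsRep u d (dAr ∷ p) (app s t) (app s t')
  esL  : ∀ {d p t t' s} → LsRep u (suc d) p t t' → LsRep u d (dσl ∷ p) (es t s) (es t' s)
  esR  : ∀ {d p t t' s} → LsRep u d p t t' → LsRep u d (dσr ∷ p) (es s t) (es s t')

-- Step R t t' : a step of the (full) LSC at position R.
--  * dB at position C (the application);
--  * ls at position D⟨C[x←u]⟩ (the substituted variable occurrence).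
data Step : Pos → Tm → Tm → Set where
  dB   : ∀ {L t u} →
         Step [] (app (plugL L (lam t)) u) (plugL L (es t (shift 0 (length L) u)))
  ls   : ∀ {p t t' u} → LsRep u 0 p t t' → Step (dσl ∷ p) (es t u) (es t' u)
  lamC : ∀ {p t t'} → Step p t t' → Step (dλ ∷ p) (lam t) (lam t')
  appL : ∀ {p t t' s} → Step p t t' → Step (dAl ∷ p) (app t s) (app t' s)
  appR : ∀ {p t t' s} → Step p t t' → Step (dAr ∷ p) (app s t) (app s t')
  esL  : ∀ {p t t' s} → Step p t t' → Step (dσl ∷ p) (es t s) (es t' s)
  esR  : ∀ {p t t' s} → Step p t t' → Step (dσr ∷ p) (es s t) (es s t')

-- shallow steps: steps whose position is a shallow context
-- (equivalently: closure under shallow contexts, with C shallow in ls)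

Redex : Tm → Pos → Set
Redex t Q = ∃ λ t' → Step Q t t'

-- Residuals: Res s Q Q' : Q' is a residual after the step s of the
-- position Q of its source.

Outside : Dir → Pos → Set
Outside d Q = ∀ r → Q ≢ d ∷ r

data Res : ∀ {R t t'} → Step R t t' → Pos → Pos → Set where
  dB-L   : ∀ {L t u i r} → i < length L →
           Res (dB {L} {t} {u}) (dAl ∷ (replicate i dσl ++ dσr ∷ r)) (replicate i dσl ++ dσr ∷ r)
  dB-body : ∀ {L t u r} →
           Res (dB {L} {t} {u}) (dAl ∷ (replicate (length L) dσl ++ dλ ∷ r))
                                (replicate (length L) dσl ++ dσl ∷ r)
  dB-arg : ∀ {L t u r} →
           Res (dB {L} {t} {u}) (dAr ∷ r) (replicate (length L) dσl ++ dσr ∷ r)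
  ls-keep : ∀ {p t t' u Q} {rep : LsRep u 0 p t t'} →
            Q ≢ dσl ∷ p → Outside dσr Q → Res (ls rep) Q Q
  ls-orig : ∀ {p t t' u r} {rep : LsRep u 0 p t t'} →
            Res (ls rep) (dσr ∷ r) (dσr ∷ r)
  ls-copy : ∀ {p t t' u r} {rep : LsRep u 0 p t t'} →
            Res (ls rep) (dσr ∷ r) (dσl ∷ (p ++ r))
  lamC-in  : ∀ {p t t' Q Q'} {s : Step p t t'} → Res s Q Q' → Res (lamC s) (dλ ∷ Q) (dλ ∷ Q')
  lamC-out : ∀ {p t t' Q} {s : Step p t t'} → Outside dλ Q → Res (lamC s) Q Q
  appL-in  : ∀ {p t t' u Q Q'} {s : Step p t t'} → Res s Q Q' → Res (appL {s = u} s) (dAl ∷ Q) (dAl ∷ Q')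
  appL-out : ∀ {p t t' u Q} {s : Step p t t'} → Outside dAl Q → Res (appL {s = u} s) Q Q
  appR-in  : ∀ {p t t' u Q Q'} {s : Step p t t'} → Res s Q Q' → Res (appR {s = u} s) (dAr ∷ Q) (dAr ∷ Q')
  appR-out : ∀ {p t t' u Q} {s : Step p t t'} → Outside dAr Q → Res (appR {s = u} s) Q Q
  esL-in   : ∀ {p t t' u Q Q'} {s : Step p t t'} → Res s Q Q' → Res (esL {s = u} s) (dσl ∷ Q) (dσl ∷ Q')
  esL-out  : ∀ {p t t' u Q} {s : Step p t t'} → Outside dσl Q → Res (esL {s = u} s) Q Q
  esR-in   : ∀ {p t t' u Q Q'} {s : Step p t t'} → Res s Q Q' → Res (esR {s = u} s) (dσr ∷ Q) (dσr ∷ Q')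
  esR-out  : ∀ {p t t' u Q} {s : Step p t t'} → Outside dσr Q → Res (esR {s = u} s) Q Q

_≺O_ : Pos → Pos → Set
Q ≺O R = ∃ λ d → ∃ λ r → R ≡ Q ++ d ∷ r

_≺L_ : Pos → Pos → Set
Q ≺L R = ∃ λ c → ∃ λ r₁ → ∃ λ r₂ →
  ((Q ≡ c ++ dAl ∷ r₁) × (R ≡ c ++ dAr ∷ r₂)) ⊎
  ((Q ≡ c ++ dσl ∷ r₁) × (R ≡ c ++ dσr ∷ r₂))

_≺LO_ : Pos → Pos → Set
Q ≺LO R = Q ≺O R ⊎ Q ≺L R

data Deriv : ℕ → Tm → Tm → Set where
  []  : ∀ {t} → Deriv 0 t t
  _∷_ : ∀ {k R t s u} → (Σ (Step R t s) λ _ → ShallowPos R) → Deriv k s u → Deriv (suc k) t u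

data Hits : ∀ {k t u} → Deriv k t u → Pos → Set where
  now   : ∀ {k R t s u} {st : Step R t s} {sh : ShallowPos R} {ρ : Deriv k s u} →
          Hits ((st , sh) ∷ ρ) R
  later : ∀ {k R t s u Q Q'} {st : Step R t s} {sh : ShallowPos R} {ρ : Deriv k s u} →
          Res st Q Q' → Hits ρ Q' → Hits ((st , sh) ∷ ρ) Q

-- standard derivations: no R_i (i > j) is a residual of a redex Q of
-- the source of R_j with Q ≺_LO R_j
data Standard : ∀ {k t u} → Deriv k t u → Set where
  []  : ∀ {t} → Standard ([] {t})
  _∷_ : ∀ {k R t s u} {st : Step R t s} {sh : ShallowPos R} {ρ : Deriv k s u} →
        (∀ Q Q' → Redex t Q → Q ≺LO R → Res st Q Q' → ¬ Hits ρ Q') →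
        Standard ρ → Standard ((st , sh) ∷ ρ)

-- A shallow step can break shallowness only by a dB step whose argument contains an
-- explicit substitution; call such an application impure.  Call a position blocked
-- when it is a prefix of an impure application or lies to the left of its argument.
-- Along a standard derivation from a λ-term we maintain that no redex at a blocked
-- position is ever hit by a later step (initially nothing is blocked).  Hence each
-- step is at an unblocked position, so it preserves shallowness; and every blocked
-- position of its target is a residual of itself that was either already blocked in
-- the source or ≺LO the step, so standardness propagates the invariant.
module Submission where

open import Data.Bool using (true; false)
open import Data.Empty using (⊥; ⊥-elim)
open import Data.List using (List; []; _∷_; _++_; length)
open import Data.List.Properties using (∷-injectiveʳ)
open import Data.List.Relation.Unary.All using (_∷_)
open import Data.Nat using (ℕ; suc; _<ᵇ_)
open import Data.Product as Prod using (Σ; _×_; _,_; proj₂)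
open import Data.Sum as Sum using (_⊎_; inj₁; inj₂)
open import Data.Unit using (⊤)
open import Function using (id; _∘_)
open import Relation.Nullary using (¬_)
open import Relation.Binary.PropositionalEquality using (_≡_; _≢_; refl; sym; cong; subst)

open import Defs

HasES : Tm → Set
HasES (var _)   = ⊥
HasES (lam t)   = HasES t
HasES (app t u) = HasES t ⊎ HasES u
HasES (es _ _)  = ⊤

LambdaTerm⇒¬HasES : ∀ {t} → LambdaTerm t → ¬ HasES t
LambdaTerm⇒¬HasES var       ()
LambdaTerm⇒¬HasES (lam l)   h        = LambdaTerm⇒¬HasES l h
LambdaTerm⇒¬HasES (app l m) (inj₁ h) = LambdaTerm⇒¬HasES l h
LambdaTerm⇒¬HasES (app l m) (inj₂ h) = LambdaTerm⇒¬HasES m h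

¬HasES⇒LambdaTerm : ∀ t → ¬ HasES t → LambdaTerm t
¬HasES⇒LambdaTerm (var _)   n = var
¬HasES⇒LambdaTerm (lam t)   n = lam (¬HasES⇒LambdaTerm t n)
¬HasES⇒LambdaTerm (app t u) n = app (¬HasES⇒LambdaTerm t (n ∘ inj₁)) (¬HasES⇒LambdaTerm u (n ∘ inj₂))
¬HasES⇒LambdaTerm (es _ _)  n = ⊥-elim (n _)

shift-LambdaTerm : ∀ c k {t} → LambdaTerm t → LambdaTerm (shift c k t)
shift-LambdaTerm c k (var {i}) with i <ᵇ c
... | true  = var
... | false = var
shift-LambdaTerm c k (lam l)   = lam (shift-LambdaTerm (suc c) k l)
shift-LambdaTerm c k (app l m) = app (shift-LambdaTerm c k l) (shift-LambdaTerm c k m)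

LambdaTerm⇒ShallowTerm : ∀ {t} → LambdaTerm t → ShallowTerm t
LambdaTerm⇒ShallowTerm var       = var
LambdaTerm⇒ShallowTerm (lam l)   = lam (LambdaTerm⇒ShallowTerm l)
LambdaTerm⇒ShallowTerm (app l m) = app (LambdaTerm⇒ShallowTerm l) (LambdaTerm⇒ShallowTerm m)

-- Only function sides and ES bodies are searched: an impure application inside an
-- argument already makes that argument contain an ES.
HasImpureApp : Tm → Set
HasImpureApp (var _)   = ⊥
HasImpureApp (lam t)   = HasImpureApp t
HasImpureApp (app t u) = HasES u ⊎ HasImpureApp t
HasImpureApp (es t _)  = HasImpureApp t

HasImpureApp⇒HasES : ∀ t → HasImpureApp t → HasES t
HasImpureApp⇒HasES (lam t)   h        = HasImpureApp⇒HasES t h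
HasImpureApp⇒HasES (app t u) (inj₁ h) = inj₂ h
HasImpureApp⇒HasES (app t u) (inj₂ h) = inj₁ (HasImpureApp⇒HasES t h)
HasImpureApp⇒HasES (es t u)  h        = _

HasImpureApp-plugL : ∀ L x → HasImpureApp (plugL L x) ≡ HasImpureApp x
HasImpureApp-plugL []      x = refl
HasImpureApp-plugL (v ∷ L) x = HasImpureApp-plugL L (es x v)

dB-HasImpureApp⁻ : ∀ L t u → HasImpureApp (plugL L (es t u)) → HasImpureApp (plugL L (lam t))
dB-HasImpureApp⁻ L t u =
  subst id (sym (HasImpureApp-plugL L (lam t))) ∘ subst id (HasImpureApp-plugL L (es t u))

data Blocked : Tm → Pos → Set where
  root           : ∀ {t} → HasImpureApp t → Blocked t []
  lam            : ∀ {t Q} → Blocked t Q → Blocked (lam t) (dλ ∷ Q)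
  left-of-impure : ∀ {t u Q} → HasES u → ShallowPos Q → Blocked (app t u) (dAl ∷ Q)
  appL           : ∀ {t u Q} → Blocked t Q → Blocked (app t u) (dAl ∷ Q)
  appR           : ∀ {t u Q} → Blocked u Q → Blocked (app t u) (dAr ∷ Q)
  esL            : ∀ {t u Q} → Blocked t Q → Blocked (es t u) (dσl ∷ Q)

Blocked⇒HasImpureApp : ∀ {t Q} → Blocked t Q → HasImpureApp t
Blocked⇒HasImpureApp (root h)               = h
Blocked⇒HasImpureApp (lam b)                = Blocked⇒HasImpureApp b
Blocked⇒HasImpureApp (left-of-impure h _)   = inj₁ h
Blocked⇒HasImpureApp (appL b)               = inj₂ (Blocked⇒HasImpureApp b)
Blocked⇒HasImpureApp {app _ u} (appR b)     = inj₁ (HasImpureApp⇒HasES u (Blocked⇒HasImpureApp b))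
Blocked⇒HasImpureApp (esL b)                = Blocked⇒HasImpureApp b

LambdaTerm⇒¬HasImpureApp : ∀ {t} → LambdaTerm t → ¬ HasImpureApp t
LambdaTerm⇒¬HasImpureApp {t} l = LambdaTerm⇒¬HasES l ∘ HasImpureApp⇒HasES t

LambdaTerm⇒¬Blocked : ∀ {t Q} → LambdaTerm t → ¬ Blocked t Q
LambdaTerm⇒¬Blocked l = LambdaTerm⇒¬HasImpureApp l ∘ Blocked⇒HasImpureApp

≺LO-∷ : ∀ d {Q R} → Q ≺LO R → (d ∷ Q) ≺LO (d ∷ R)
≺LO-∷ d (inj₁ (e , r , eq)) = inj₁ (e , r , cong (d ∷_) eq)
≺LO-∷ d (inj₂ (c , r₁ , r₂ , inj₁ (e₁ , e₂))) = inj₂ (d ∷ c , r₁ , r₂ , inj₁ (cong (d ∷_) e₁ , cong (d ∷_) e₂))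
≺LO-∷ d (inj₂ (c , r₁ , r₂ , inj₂ (e₁ , e₂))) = inj₂ (d ∷ c , r₁ , r₂ , inj₂ (cong (d ∷_) e₁ , cong (d ∷_) e₂))

[]≺LO∷ : ∀ {d R} → [] ≺LO (d ∷ R)
[]≺LO∷ {d} {R} = inj₁ (d , R , refl)

appL≺LOappR : ∀ {Q R} → (dAl ∷ Q) ≺LO (dAr ∷ R)
appL≺LOappR {Q} {R} = inj₂ ([] , Q , R , inj₁ (refl , refl))

data VarAt : Tm → Pos → ℕ → Set where
  here : ∀ {d} → VarAt (var d) [] d
  lamC : ∀ {t p d} → VarAt t p (suc d) → VarAt (lam t) (dλ ∷ p) d
  appL : ∀ {t s p d} → VarAt t p d → VarAt (app t s) (dAl ∷ p) d
  appR : ∀ {t s p d} → VarAt t p d → VarAt (app s t) (dAr ∷ p) d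
  esL  : ∀ {t s p d} → VarAt t p (suc d) → VarAt (es t s) (dσl ∷ p) d
  esR  : ∀ {t s p d} → VarAt t p d → VarAt (es s t) (dσr ∷ p) d

LsRep⇒VarAt : ∀ {u d p t t'} → LsRep u d p t t' → VarAt t p d
LsRep⇒VarAt here     = here
LsRep⇒VarAt (lamC r) = lamC (LsRep⇒VarAt r)
LsRep⇒VarAt (appL r) = appL (LsRep⇒VarAt r)
LsRep⇒VarAt (appR r) = appR (LsRep⇒VarAt r)
LsRep⇒VarAt (esL r)  = esL (LsRep⇒VarAt r)
LsRep⇒VarAt (esR r)  = esR (LsRep⇒VarAt r)

VarAt⇒LsRep : ∀ {u d p t} → VarAt t p d → Σ Tm (LsRep u d p t)
VarAt⇒LsRep here     = _ , here
VarAt⇒LsRep (lamC v) = Prod.map lam lamC (VarAt⇒LsRep v)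
VarAt⇒LsRep (appL v) = Prod.map _ appL (VarAt⇒LsRep v)
VarAt⇒LsRep (appR v) = Prod.map _ appR (VarAt⇒LsRep v)
VarAt⇒LsRep (esL v)  = Prod.map _ esL (VarAt⇒LsRep v)
VarAt⇒LsRep (esR v)  = Prod.map _ esR (VarAt⇒LsRep v)

data LamUnderSubst : Tm → Set where
  lam : ∀ {t} → LamUnderSubst (lam t)
  es  : ∀ {t u} → LamUnderSubst t → LamUnderSubst (es t u)

plugL-snoc : ∀ L x u → plugL (L ++ u ∷ []) x ≡ es (plugL L x) u
plugL-snoc []      x u = refl
plugL-snoc (v ∷ L) x u = plugL-snoc L (es x v) u

LamUnderSubst-plugL : ∀ L {x} → LamUnderSubst x → LamUnderSubst (plugL L x)
LamUnderSubst-plugL []      l = l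
LamUnderSubst-plugL (u ∷ L) l = LamUnderSubst-plugL L (es l)

LamUnderSubst⇒plugL : ∀ {t} → LamUnderSubst t → Σ (List Tm) λ L → Σ Tm λ x → t ≡ plugL L (lam x)
LamUnderSubst⇒plugL (lam {t}) = [] , t , refl
LamUnderSubst⇒plugL (es {u = u} l) with LamUnderSubst⇒plugL l
... | L , x , refl = L ++ u ∷ [] , x , sym (plugL-snoc L (lam x) u)

LamUnderSubst⇒app-redex : ∀ {t u} → LamUnderSubst t → Redex (app t u) []
LamUnderSubst⇒app-redex l with LamUnderSubst⇒plugL l
... | L , x , refl = _ , dB {L} {x}

app-redex⇒LamUnderSubst : ∀ {t u} → Redex (app t u) [] → LamUnderSubst t
app-redex⇒LamUnderSubst (_ , dB {L}) = LamUnderSubst-plugL L lam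

-- A substituted λ-term contains no impure application.
ls-LamUnderSubst⁻ : ∀ {u d p t t'} → LsRep u d p t t' → LambdaTerm u →
                    LamUnderSubst t' → LamUnderSubst t ⊎ ¬ HasImpureApp t'
ls-LamUnderSubst⁻ {d = d} here l _ =
  inj₂ (LambdaTerm⇒¬HasImpureApp (shift-LambdaTerm 0 (suc d) l))
ls-LamUnderSubst⁻ (lamC r) l _      = inj₁ lam
ls-LamUnderSubst⁻ (esL r)  l (es s) = Sum.map₁ es (ls-LamUnderSubst⁻ r l s)
ls-LamUnderSubst⁻ (esR r)  l (es s) = inj₁ (es s)

step-LamUnderSubst⁻ : ∀ {R t t'} → ShallowTerm t → Step R t t' →
                      LamUnderSubst t' → LamUnderSubst t ⊎ (HasImpureApp t' → Blocked t R)
step-LamUnderSubst⁻ _ (dB {L} {t}) _ = inj₂ (root ∘ inj₂ ∘ dB-HasImpureApp⁻ L t _)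
step-LamUnderSubst⁻ (es _ lu) (ls r) (es s) =
  Sum.map es (λ n → ⊥-elim ∘ n) (ls-LamUnderSubst⁻ r lu s)
step-LamUnderSubst⁻ _         (lamC st) _      = inj₁ lam
step-LamUnderSubst⁻ (es sh _) (esL st)  (es s) = Sum.map es (esL ∘_) (step-LamUnderSubst⁻ sh st s)
step-LamUnderSubst⁻ _         (esR st)  (es s) = inj₁ (es s)

appL-root-LamUnderSubst⁻ : ∀ {R t t' u} → ShallowPos R → ¬ Blocked (app t u) (dAl ∷ R) →
                           Blocked (app t' u) [] →
                           LamUnderSubst t ⊎ (HasImpureApp t' → Blocked t R) → LamUnderSubst t
appL-root-LamUnderSubst⁻ _  _  _        (inj₁ l) = l
appL-root-LamUnderSubst⁻ sp nb (root (inj₁ h)) (inj₂ _) = ⊥-elim (nb (left-of-impure h sp))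
appL-root-LamUnderSubst⁻ sp nb (root (inj₂ h)) (inj₂ g) = ⊥-elim (nb (appL (g h)))

ls-preserves-shallow : ∀ {u d p t t'} → LsRep u d p t t' → ShallowPos p → LambdaTerm u →
                       ShallowTerm t → ShallowTerm t'
ls-preserves-shallow {d = d} here _ l _ = LambdaTerm⇒ShallowTerm (shift-LambdaTerm 0 (suc d) l)
ls-preserves-shallow (lamC r) (_ ∷ sp) l (lam sh)     = lam (ls-preserves-shallow r sp l sh)
ls-preserves-shallow (appL r) (_ ∷ sp) l (app sh sh′) = app (ls-preserves-shallow r sp l sh) sh′
ls-preserves-shallow (appR r) (_ ∷ sp) l (app sh sh′) = app sh (ls-preserves-shallow r sp l sh′)
ls-preserves-shallow (esL r)  (_ ∷ sp) l (es sh lu)   = es (ls-preserves-shallow r sp l sh) lu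
ls-preserves-shallow (esR r)  (n ∷ _)  _ _            = ⊥-elim (n refl)

shallow-plugL⁻ : ∀ L x → ShallowTerm (plugL L x) →
                 ShallowTerm x × (∀ {y} → ShallowTerm y → ShallowTerm (plugL L y))
shallow-plugL⁻ []      x sh = sh , id
shallow-plugL⁻ (v ∷ L) x sh with shallow-plugL⁻ L (es x v) sh
... | es shx lv , plug = shx , λ shy → plug (es shy lv)

step-preserves-shallow : ∀ {R s s'} → Step R s s' → ShallowPos R → ShallowTerm s →
                         ¬ Blocked s R → ShallowTerm s'
step-preserves-shallow (dB {L} {t} {u}) _ (app shf _) nb with shallow-plugL⁻ L (lam t) shf
... | lam sht , plug =
  plug (es sht (shift-LambdaTerm 0 (length L) (¬HasES⇒LambdaTerm u (nb ∘ root ∘ inj₁))))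
step-preserves-shallow (ls r)    (_ ∷ sp) (es sh lu)    nb = es (ls-preserves-shallow r sp lu sh) lu
step-preserves-shallow (lamC st) (_ ∷ sp) (lam sh)      nb = lam (step-preserves-shallow st sp sh (nb ∘ lam))
step-preserves-shallow (appL st) (_ ∷ sp) (app sh sh′)  nb = app (step-preserves-shallow st sp sh (nb ∘ appL)) sh′
step-preserves-shallow (appR st) (_ ∷ sp) (app sh sh′)  nb = app sh (step-preserves-shallow st sp sh′ (nb ∘ appR))
step-preserves-shallow (esL st)  (_ ∷ sp) (es sh lu)    nb = es (step-preserves-shallow st sp sh (nb ∘ esL)) lu
step-preserves-shallow (esR st)  (n ∷ _)  _             _  = ⊥-elim (n refl)

record TracesBack (s s' : Tm) (R Q : Pos) : Set where
  field
    blocked-or-≺LO : Blocked s Q ⊎ Q ≺LO R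
    redex⁻         : Redex s' Q → Redex s Q
    varAt⁻         : ∀ {d} → VarAt s' Q d → VarAt s Q d

open TracesBack

traces-lam : ∀ {t t' R Q} → TracesBack t t' R Q → TracesBack (lam t) (lam t') (dλ ∷ R) (dλ ∷ Q)
blocked-or-≺LO (traces-lam tb) = Sum.map lam (≺LO-∷ dλ) (blocked-or-≺LO tb)
redex⁻ (traces-lam tb) (_ , lamC st) = Prod.map lam lamC (redex⁻ tb (_ , st))
varAt⁻ (traces-lam tb) (lamC v) = lamC (varAt⁻ tb v)

traces-appL : ∀ {t t' u R Q} → TracesBack t t' R Q →
              TracesBack (app t u) (app t' u) (dAl ∷ R) (dAl ∷ Q)
blocked-or-≺LO (traces-appL tb) = Sum.map appL (≺LO-∷ dAl) (blocked-or-≺LO tb)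
redex⁻ (traces-appL tb) (_ , appL st) = Prod.map _ appL (redex⁻ tb (_ , st))
varAt⁻ (traces-appL tb) (appL v) = appL (varAt⁻ tb v)

traces-appR : ∀ {t u u' R Q} → TracesBack u u' R Q →
              TracesBack (app t u) (app t u') (dAr ∷ R) (dAr ∷ Q)
blocked-or-≺LO (traces-appR tb) = Sum.map appR (≺LO-∷ dAr) (blocked-or-≺LO tb)
redex⁻ (traces-appR tb) (_ , appR st) = Prod.map _ appR (redex⁻ tb (_ , st))
varAt⁻ (traces-appR tb) (appR v) = appR (varAt⁻ tb v)

traces-esL : ∀ {t t' u R Q} → TracesBack t t' R Q →
             TracesBack (es t u) (es t' u) (dσl ∷ R) (dσl ∷ Q)
blocked-or-≺LO (traces-esL tb) = Sum.map esL (≺LO-∷ dσl) (blocked-or-≺LO tb)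
redex⁻ (traces-esL tb) (_ , esL st) = Prod.map _ esL (redex⁻ tb (_ , st))
redex⁻ (traces-esL tb) (_ , ls r) = _ , ls (proj₂ (VarAt⇒LsRep (varAt⁻ tb (LsRep⇒VarAt r))))
varAt⁻ (traces-esL tb) (esL v) = esL (varAt⁻ tb v)

traces-appL-arg : ∀ {t t' u R Q} → Blocked u Q → TracesBack (app t u) (app t' u) (dAl ∷ R) (dAr ∷ Q)
blocked-or-≺LO (traces-appL-arg b) = inj₁ (appR b)
redex⁻ (traces-appL-arg b) (_ , appR st) = _ , appR st
varAt⁻ (traces-appL-arg b) (appR v) = appR v

traces-appR-fun : ∀ {t u u' R Q} → Blocked (app t u') (dAl ∷ Q) →
                  TracesBack (app t u) (app t u') (dAr ∷ R) (dAl ∷ Q)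
blocked-or-≺LO (traces-appR-fun (left-of-impure _ _)) = inj₂ appL≺LOappR
blocked-or-≺LO (traces-appR-fun (appL b)) = inj₁ (appL b)
redex⁻ (traces-appR-fun b) (_ , appL st) = _ , appL st
varAt⁻ (traces-appR-fun b) (appL v) = appL v

traces-lam-root : ∀ {t t' R} → TracesBack (lam t) (lam t') (dλ ∷ R) []
blocked-or-≺LO traces-lam-root = inj₂ []≺LO∷
redex⁻ traces-lam-root (_ , ())
varAt⁻ traces-lam-root ()

traces-es-root : ∀ {t t' u R} → TracesBack (es t u) (es t' u) (dσl ∷ R) []
blocked-or-≺LO traces-es-root = inj₂ []≺LO∷
redex⁻ traces-es-root (_ , ())
varAt⁻ traces-es-root ()

traces-app-root : ∀ {t t' u u' d R} → (LamUnderSubst t' → LamUnderSubst t) →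
                  TracesBack (app t u) (app t' u') (d ∷ R) []
blocked-or-≺LO (traces-app-root f) = inj₂ []≺LO∷
redex⁻ (traces-app-root f) = LamUnderSubst⇒app-redex ∘ f ∘ app-redex⇒LamUnderSubst
varAt⁻ (traces-app-root f) ()

ls-blocked-traces : ∀ {u d p t t' Q} → LsRep u d p t t' → ShallowPos p → LambdaTerm u →
                    ¬ Blocked t p → Blocked t' Q → Q ≢ p × TracesBack t t' p Q
ls-blocked-traces {d = d} here _ l _ b = ⊥-elim (LambdaTerm⇒¬Blocked (shift-LambdaTerm 0 (suc d) l) b)
ls-blocked-traces (lamC r) _ _ _ (root _) = (λ ()) , traces-lam-root
ls-blocked-traces (lamC r) (_ ∷ sp) l nb (lam b) =
  Prod.map (_∘ ∷-injectiveʳ) traces-lam (ls-blocked-traces r sp l (nb ∘ lam) b)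
ls-blocked-traces (appL r) (_ ∷ sp) l nb b@(root _) =
  (λ ()) , traces-app-root (appL-root-LamUnderSubst⁻ sp nb b
                             ∘ Sum.map₂ (λ n → ⊥-elim ∘ n) ∘ ls-LamUnderSubst⁻ r l)
ls-blocked-traces (appL r) (_ ∷ sp) l nb (left-of-impure h _) = ⊥-elim (nb (left-of-impure h sp))
ls-blocked-traces (appL r) (_ ∷ sp) l nb (appL b) =
  Prod.map (_∘ ∷-injectiveʳ) traces-appL (ls-blocked-traces r sp l (nb ∘ appL) b)
ls-blocked-traces (appL r) _ _ _ (appR b) = (λ ()) , traces-appL-arg b
ls-blocked-traces (appR r) _ _ _ (root _) = (λ ()) , traces-app-root id
ls-blocked-traces (appR r) _ _ _ b@(left-of-impure _ _) = (λ ()) , traces-appR-fun b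
ls-blocked-traces (appR r) _ _ _ b@(appL _) = (λ ()) , traces-appR-fun b
ls-blocked-traces (appR r) (_ ∷ sp) l nb (appR b) =
  Prod.map (_∘ ∷-injectiveʳ) traces-appR (ls-blocked-traces r sp l (nb ∘ appR) b)
ls-blocked-traces (esL r) _ _ _ (root _) = (λ ()) , traces-es-root
ls-blocked-traces (esL r) (_ ∷ sp) l nb (esL b) =
  Prod.map (_∘ ∷-injectiveʳ) traces-esL (ls-blocked-traces r sp l (nb ∘ esL) b)
ls-blocked-traces (esR r) (n ∷ _) _ _ _ = ⊥-elim (n refl)

step-blocked-traces : ∀ {R s s' Q} (st : Step R s s') → ShallowPos R → ShallowTerm s →
                      ¬ Blocked s R → Blocked s' Q → Res st Q Q × TracesBack s s' R Q
step-blocked-traces (dB {L} {t}) _ _ nb b =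
  ⊥-elim (nb (root (inj₂ (dB-HasImpureApp⁻ L t _ (Blocked⇒HasImpureApp b)))))
step-blocked-traces (ls r) _ _ _ (root _) = ls-keep (λ ()) (λ _ ()) , traces-es-root
step-blocked-traces (ls r) (_ ∷ sp) (es _ lu) nb (esL b) =
  Prod.map (λ ne → ls-keep (ne ∘ ∷-injectiveʳ) (λ _ ())) traces-esL
           (ls-blocked-traces r sp lu (nb ∘ esL) b)
step-blocked-traces (lamC st) _ _ _ (root _) = lamC-out (λ _ ()) , traces-lam-root
step-blocked-traces (lamC st) (_ ∷ sp) (lam sh) nb (lam b) =
  Prod.map lamC-in traces-lam (step-blocked-traces st sp sh (nb ∘ lam) b)
step-blocked-traces (appL st) (_ ∷ sp) (app sh _) nb b@(root _) =
  appL-out (λ _ ()) , traces-app-root (appL-root-LamUnderSubst⁻ sp nb b ∘ step-LamUnderSubst⁻ sh st)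
step-blocked-traces (appL st) (_ ∷ sp) _ nb (left-of-impure h _) = ⊥-elim (nb (left-of-impure h sp))
step-blocked-traces (appL st) (_ ∷ sp) (app sh _) nb (appL b) =
  Prod.map appL-in traces-appL (step-blocked-traces st sp sh (nb ∘ appL) b)
step-blocked-traces (appL st) _ _ _ (appR b) = appL-out (λ _ ()) , traces-appL-arg b
step-blocked-traces (appR st) _ _ _ (root _) = appR-out (λ _ ()) , traces-app-root id
step-blocked-traces (appR st) _ _ _ b@(left-of-impure _ _) = appR-out (λ _ ()) , traces-appR-fun b
step-blocked-traces (appR st) _ _ _ b@(appL _) = appR-out (λ _ ()) , traces-appR-fun b
step-blocked-traces (appR st) (_ ∷ sp) (app _ sh) nb (appR b) =
  Prod.map appR-in traces-appR (step-blocked-traces st sp sh (nb ∘ appR) b)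
step-blocked-traces (esL st) _ _ _ (root _) = esL-out (λ _ ()) , traces-es-root
step-blocked-traces (esL st) (_ ∷ sp) (es sh _) nb (esL b) =
  Prod.map esL-in traces-esL (step-blocked-traces st sp sh (nb ∘ esL) b)
step-blocked-traces (esR st) (n ∷ _) _ _ _ = ⊥-elim (n refl)

BlockedRedexesUnhit : ∀ {k s u} → Deriv k s u → Set
BlockedRedexesUnhit {s = s} ρ = ∀ {Q} → Blocked s Q → Redex s Q → ¬ Hits ρ Q

standard-preserves-shallow : ∀ {k s u} (ρ : Deriv k s u) → ShallowTerm s → Standard ρ →
                             BlockedRedexesUnhit ρ → ShallowTerm u
standard-preserves-shallow [] sh _ _ = sh
standard-preserves-shallow ((st , sp) ∷ ρ) sh (std ∷ stdρ) unhit =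
  standard-preserves-shallow ρ (step-preserves-shallow st sp sh nb) stdρ unhit′
  where
  nb : ¬ Blocked _ _
  nb b = unhit b (_ , st) now
  unhit′ : BlockedRedexesUnhit ρ
  unhit′ {Q} b rdx hit with step-blocked-traces st sp sh nb b
  ... | res , tb with blocked-or-≺LO tb
  ...   | inj₁ b₀ = unhit b₀ (redex⁻ tb rdx) (later res hit)
  ...   | inj₂ lo = std Q Q (redex⁻ tb rdx) lo res hit

mainTheorem12 : ∀ {k t u} (ρ : Deriv k t u) → LambdaTerm t → Standard ρ → ShallowTerm u
mainTheorem12 ρ l std =
  standard-preserves-shallow ρ (LambdaTerm⇒ShallowTerm l) std (λ b _ _ → LambdaTerm⇒¬Blocked l b)
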